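{- For every $f:\{0,1\}^n\to\{0,1\}$, $\mathsf{alt}(f)\le 2^{\mathsf{DT}(f)+1}-1$.
   Context: $\mathsf{alt}(f)$ is the maximum, over chains $0^n=x_0\prec x_1\prec\dots\prec x_n=1^n$ of distinct inputs (with $\prec$ the coordinatewise order), of the number of $i$ with $f(x_{i-1})\ne f(x_i)$. $\mathsf{DT}(f)$ is the minimum depth of a deterministic decision tree computing $f$. -}

module Defs where

open import Data.Bool using (Bool; true; false; _≤_; if_then_else_)
open import Data.Nat as ℕ using (ℕ; zero; suc; _⊔_)
open import Data.Fin using (Fin; zero; suc; inject₁; fromℕ)
open import Data.Vec using (Vec; lookup; replicate; tabulate; sum)
open import Data.Product using (Σ; _×_; _,_)
open import Relation.Binary.PropositionalEquality using (_≡_; _≢_)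
open import Relation.Nullary using (does)
open import Data.Bool.Properties using () renaming (_≟_ to _≟B_)

-- Inputs {0,1}^n, with false = 0 and true = 1.
Input : ℕ → Set
Input n = Vec Bool n

BoolFun : ℕ → Set
BoolFun n = Input n → Bool

_≼_ : ∀ {n} → Input n → Input n → Set
x ≼ y = ∀ i → lookup x i ≤ lookup y i

_≺_ : ∀ {n} → Input n → Input n → Set
x ≺ y = (x ≼ y) × (x ≢ y)

record Chain (n : ℕ) : Set where
  field
    pt     : Fin (suc n) → Input n
    start  : pt zero ≡ replicate n false
    finish : pt (fromℕ n) ≡ replicate n true
    step   : (i : Fin n) → pt (inject₁ i) ≺ pt (suc i)
open Chain public

alternations : ∀ {n} → BoolFun n → Chain n → ℕ
alternations {n} f c =
  sum (tabulate {n = n} λ i →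
    if does (f (pt c (inject₁ i)) ≟B f (pt c (suc i))) then 0 else 1)

IsAlt : ∀ {n} → BoolFun n → ℕ → Set
IsAlt {n} f a =
  Σ (Chain n) (λ c → alternations f c ≡ a) × ((c : Chain n) → alternations f c ℕ.≤ a)

data DTree (n : ℕ) : Set where
  leaf  : Bool → DTree n
  query : Fin n → DTree n → DTree n → DTree n

eval : ∀ {n} → DTree n → Input n → Bool
eval (leaf b) x = b
eval (query i t₀ t₁) x = if lookup x i then eval t₁ x else eval t₀ x

depth : ∀ {n} → DTree n → ℕ
depth (leaf _) = 0
depth (query _ t₀ t₁) = suc (depth t₀ ⊔ depth t₁)

Computes : ∀ {n} → DTree n → BoolFun n → Set
Computes t f = ∀ x → eval t x ≡ f x

IsDT : ∀ {n} → BoolFun n → ℕ → Set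
IsDT {n} f d =
  Σ (DTree n) (λ t → Computes t f × depth t ≡ d)
  × ((t : DTree n) → Computes t f → d ℕ.≤ depth t)

module Submission where

-- Read a chain as a monotone walk x₀ ≼ x₁ ≼ … in the cube and
-- count the steps at which a function g changes value.  We prove, for every
-- decision tree t and every monotone walk, that
--     (number of changes of eval t along the walk) + 1 ≤ 2 ^ depth t,
-- by induction on t.  For a leaf the function is constant.  For a root
-- querying x_i, a monotone walk first stays in the half-cube x_i = 0, where
-- eval t agrees with the left subtree t₀, and, once x_i becomes 1, stays in
-- the half-cube x_i = 1, where it agrees with the right subtree t₁.  So the
-- changes split into those of t₀ on a prefix, at most one crossing step, and
-- those of t₁ on a suffix, giving the bound 2 ^ depth t₀ + 2 ^ depth t₁.
-- Applied to a chain of maximal alternation and a tree of minimal depth this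
-- yields alt(f) ≤ 2 ^ DT(f) − 1, which is stronger than the stated bound.

open import Defs
open import Data.Nat using (ℕ; _≤_; _∸_; _^_; suc; zero; _+_; _⊔_; z≤n; s≤s)
open import Data.Nat.Properties
open import Data.Bool as Bool using (Bool; true; false; if_then_else_; b≤b; f≤t)
open import Data.Bool.Properties using () renaming (_≟_ to _≟B_)
open import Data.Fin using (Fin; inject₁) renaming (zero to fzero; suc to fsuc)
open import Data.Vec using (lookup; tabulate; sum)
open import Data.List using (List; []; _∷_)
open import Data.Product using (Σ; _×_; _,_; proj₁)
open import Relation.Binary.PropositionalEquality
open import Relation.Nullary using (does)

differ : Bool → Bool → ℕ
differ a b = if does (a ≟B b) then 0 else 1

differ-refl : ∀ a → differ a a ≡ 0
differ-refl false = refl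
differ-refl true  = refl

differ≤1 : ∀ a b → differ a b ≤ 1
differ≤1 false false = z≤n
differ≤1 false true  = s≤s z≤n
differ≤1 true  false = s≤s z≤n
differ≤1 true  true  = z≤n

true-upward : ∀ {n} {x y : Input n} (i : Fin n) →
              x ≼ y → lookup x i ≡ true → lookup y i ≡ true
true-upward {x = x} {y} i x≼y = go (x≼y i)
  where
  go : ∀ {a b} → a Bool.≤ b → a ≡ true → b ≡ true
  go b≤b a≡true = a≡true
  go f≤t _      = refl

module _ {n : ℕ} where

  changes : BoolFun n → Input n → List (Input n) → ℕ
  changes g x []       = 0
  changes g x (y ∷ ys) = differ (g x) (g y) + changes g y ys

  data Walk : Input n → List (Input n) → Set where
    []  : ∀ {x} → Walk x []
    _∷_ : ∀ {x y ys} → x ≼ y → Walk y ys → Walk x (y ∷ ys)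

  changes-ext : ∀ {g h : BoolFun n} → (∀ x → g x ≡ h x) →
                ∀ x ys → changes g x ys ≡ changes h x ys
  changes-ext g≗h x []       = refl
  changes-ext g≗h x (y ∷ ys) =
    cong₂ _+_ (cong₂ differ (g≗h x) (g≗h y)) (changes-ext g≗h y ys)

  changes-const : ∀ b x ys → changes (λ _ → b) x ys ≡ 0
  changes-const b x []       = refl
  changes-const b x (y ∷ ys) rewrite differ-refl b = changes-const b y ys

  module Split (i : Fin n) (g g₀ g₁ : BoolFun n)
               (lower : ∀ x → lookup x i ≡ false → g x ≡ g₀ x)
               (upper : ∀ x → lookup x i ≡ true  → g x ≡ g₁ x) where

    -- A monotone walk starting in the upper half-cube never leaves it.
    changes-upper : ∀ x ys → lookup x i ≡ true → Walk x ys →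
                    changes g x ys ≡ changes g₁ x ys
    changes-upper x []       xᵢ≡1 []          = refl
    changes-upper x (y ∷ ys) xᵢ≡1 (x≼y ∷ walk) =
      cong₂ _+_ (cong₂ differ (upper x xᵢ≡1) (upper y yᵢ≡1))
                (changes-upper y ys yᵢ≡1 walk)
      where
      yᵢ≡1 : lookup y i ≡ true
      yᵢ≡1 = true-upward {x = x} {y} i x≼y xᵢ≡1

    module _ (B₁ : ℕ) (bound₁ : ∀ x ys → Walk x ys → suc (changes g₁ x ys) ≤ B₁) where

      -- A walk starting in the lower half-cube: its changes are those of g₀
      -- on its lower prefix, plus at most B₁ for the crossing step and the
      -- rest of the walk (which lies in the upper half-cube).
      changes-lower : ∀ x ys → lookup x i ≡ false → Walk x ys →
                      Σ (List (Input n)) λ prefix →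
                        Walk x prefix × changes g x ys ≤ changes g₀ x prefix + B₁
      changes-lower x []       xᵢ≡0 []          = [] , [] , z≤n
      changes-lower x (y ∷ ys) xᵢ≡0 (x≼y ∷ walk) with lookup y i in yᵢ
      ... | true  = [] , [] , crossing
        where
        open ≤-Reasoning
        crossing : changes g x (y ∷ ys) ≤ B₁
        crossing = begin
          differ (g x) (g y) + changes g y ys ≤⟨ +-monoˡ-≤ _ (differ≤1 (g x) (g y)) ⟩
          suc (changes g y ys)                ≡⟨ cong suc (changes-upper y ys yᵢ walk) ⟩
          suc (changes g₁ y ys)               ≤⟨ bound₁ y ys walk ⟩
          B₁                                  ∎
      ... | false with changes-lower y ys yᵢ walk
      ...   | prefix , walk′ , ih = y ∷ prefix , x≼y ∷ walk′ , extend
        where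
        open ≤-Reasoning
        d₀ : ℕ
        d₀ = differ (g₀ x) (g₀ y)
        extend : changes g x (y ∷ ys) ≤ changes g₀ x (y ∷ prefix) + B₁
        extend = begin
          differ (g x) (g y) + changes g y ys   ≡⟨ cong₂ (λ u v → differ u v + changes g y ys)
                                                         (lower x xᵢ≡0) (lower y yᵢ) ⟩
          d₀ + changes g y ys                   ≤⟨ +-monoʳ-≤ d₀ ih ⟩
          d₀ + (changes g₀ y prefix + B₁)       ≡⟨ +-assoc d₀ _ B₁ ⟨
          d₀ + changes g₀ y prefix + B₁         ∎

      split-bound : ∀ (B₀ : ℕ) → (∀ x ys → Walk x ys → suc (changes g₀ x ys) ≤ B₀) →
                    ∀ x ys → Walk x ys → suc (changes g x ys) ≤ B₀ + B₁
      split-bound B₀ bound₀ x ys walk with lookup x i in xᵢ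
      ... | true = begin
            suc (changes g x ys)  ≡⟨ cong suc (changes-upper x ys xᵢ walk) ⟩
            suc (changes g₁ x ys) ≤⟨ bound₁ x ys walk ⟩
            B₁                    ≤⟨ m≤n+m B₁ B₀ ⟩
            B₀ + B₁               ∎
        where open ≤-Reasoning
      ... | false with changes-lower x ys xᵢ walk
      ...   | prefix , walk′ , le = begin
            suc (changes g x ys)               ≤⟨ s≤s le ⟩
            suc (changes g₀ x prefix) + B₁     ≤⟨ +-monoˡ-≤ B₁ (bound₀ x prefix walk′) ⟩
            B₀ + B₁                            ∎
        where open ≤-Reasoning

  2^a+2^b≤2^[1+a⊔b] : ∀ a b → 2 ^ a + 2 ^ b ≤ 2 ^ suc (a ⊔ b)
  2^a+2^b≤2^[1+a⊔b] a b = begin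
      2 ^ a + 2 ^ b             ≤⟨ +-mono-≤ (^-monoʳ-≤ 2 (m≤m⊔n a b)) (^-monoʳ-≤ 2 (m≤n⊔m a b)) ⟩
      2 ^ (a ⊔ b) + 2 ^ (a ⊔ b) ≡⟨ cong (2 ^ (a ⊔ b) +_) (+-identityʳ _) ⟨
      2 ^ suc (a ⊔ b)           ∎
    where open ≤-Reasoning

  tree-changes : ∀ (t : DTree n) x ys → Walk x ys → suc (changes (eval t) x ys) ≤ 2 ^ depth t
  tree-changes (leaf b) x ys walk rewrite changes-const b x ys = s≤s z≤n
  tree-changes (query i t₀ t₁) x ys walk =
    ≤-trans (Split.split-bound i (eval (query i t₀ t₁)) (eval t₀) (eval t₁) lower upper
               (2 ^ depth t₁) (tree-changes t₁) (2 ^ depth t₀) (tree-changes t₀) x ys walk)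
            (2^a+2^b≤2^[1+a⊔b] (depth t₀) (depth t₁))
    where
    lower : ∀ x → lookup x i ≡ false → eval (query i t₀ t₁) x ≡ eval t₀ x
    lower x xᵢ≡0 rewrite xᵢ≡0 = refl
    upper : ∀ x → lookup x i ≡ true → eval (query i t₀ t₁) x ≡ eval t₁ x
    upper x xᵢ≡1 rewrite xᵢ≡1 = refl

  tail-points : ∀ m → (Fin (suc m) → Input n) → List (Input n)
  tail-points zero    p = []
  tail-points (suc m) p = p (fsuc fzero) ∷ tail-points m (λ j → p (fsuc j))

  alternations-as-changes : ∀ (g : BoolFun n) m (p : Fin (suc m) → Input n) →
    sum (tabulate {n = m} λ j → differ (g (p (inject₁ j))) (g (p (fsuc j))))
      ≡ changes g (p fzero) (tail-points m p)
  alternations-as-changes g zero    p = refl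
  alternations-as-changes g (suc m) p =
    cong (differ (g (p fzero)) (g (p (fsuc fzero))) +_)
         (alternations-as-changes g m (λ j → p (fsuc j)))

  chain-walk : ∀ m (p : Fin (suc m) → Input n) →
               (∀ j → p (inject₁ j) ≼ p (fsuc j)) → Walk (p fzero) (tail-points m p)
  chain-walk zero    p steps = []
  chain-walk (suc m) p steps = steps fzero ∷ chain-walk m (λ j → p (fsuc j)) (λ j → steps (fsuc j))

theorem8 : (n : ℕ) (f : BoolFun n) (a d : ℕ) → IsAlt f a → IsDT f d → a ≤ 2 ^ suc d ∸ 1
theorem8 n f a d ((c , alt≡a) , _) ((t , t-computes-f , depth≡d) , _) = ∸-monoˡ-≤ 1 bound
  where
  open ≤-Reasoning
  x₀ : Input n
  x₀ = pt c fzero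
  walk : List (Input n)
  walk = tail-points n (pt c)
  bound : suc a ≤ 2 ^ suc d
  bound = begin
    suc a                       ≡⟨ cong suc alt≡a ⟨
    suc (alternations f c)      ≡⟨ cong suc (alternations-as-changes f n (pt c)) ⟩
    suc (changes f x₀ walk)     ≡⟨ cong suc (changes-ext t-computes-f x₀ walk) ⟨
    suc (changes (eval t) x₀ walk)
                                ≤⟨ tree-changes t x₀ walk (chain-walk n (pt c) (λ j → proj₁ (step c j))) ⟩
    2 ^ depth t                 ≡⟨ cong (2 ^_) depth≡d ⟩
    2 ^ d                       ≤⟨ ^-monoʳ-≤ 2 (n≤1+n d) ⟩
    2 ^ suc d                   ∎
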